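{- Let $p,q$ be distinct atomic formulas. Then: (a) $p\vdash\neg\neg p$ characterizes the class of Routley IFs satisfying $s\le s^{**}$ for every state $s$; (b) $\neg\neg p\vdash p$ characterizes the class of Routley IFs satisfying $s^{**}\le s$ for every state $s$; (c) $\neg p\wedge\neg q\vdash\neg(p\vee q)$ characterizes the class of Routley IFs satisfying: for all states $s,t,u$, if $t\circ u\le s^*$ then $t\le s^*$ or $u\le s^*$.
   Context: Let $L$ be the set of formulas built from a set $At$ of atomic formulas with $\wedge,\vee,\neg$; an $L$-pair is a pair of formulas written $\alpha\vdash\beta$. A Routley IF is a structure $\langle S,\circ,*,i,e\rangle$ where $S$ is a nonempty set, $\circ$ is an associative, commutative, idempotent binary operation on $S$, $*:S\to S$, and $i\neq e$ are elements of $S$ such that: $s\circ i=s$ and $s\circ e=e$ for all $s$; if $e=t\circ u$ then $e=t$ or $e=u$; and, writing $s\le t$ iff $s\circ t=s$: $i^*=e$ and $e^*=i$; $t\le u$ implies $u^*\le t^*$; for all $t,u$, $(t\circ u)^*\le t^*$ or $(t\circ u)^*\le u^*$. A proper filter is $F\subseteq S$ with $i\in F$, $e\notin F$, and $t\circ u\in F$ iff $t\in F$ and $u\in F$. A Routley IM is a Routley IF with a valuation $V$ assigning a proper filter to each atom. Support: $s\Vdash p$ iff $s\in V(p)$; $s\Vdash\alpha\wedge\beta$ iff $s\Vdash\alpha$ and $s\Vdash\beta$; $s\Vdash\alpha\vee\beta$ iff there are $t,u$ with $t\Vdash\alpha$, $u\Vdash\beta$, $t\circ u\le s$; $s\Vdash\neg\alpha$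 iff $s^*\nVdash\alpha$. $\alpha\vdash\beta$ is valid in a Routley IM if every state supporting $\alpha$ supports $\beta$, and valid in a Routley IF if it is valid in every Routley IM based on it. An $L$-pair characterizes a class $\mathcal{C}$ of Routley IFs if for every Routley IF $\mathcal{I}$: the pair is valid in $\mathcal{I}$ iff $\mathcal{I}\in\mathcal{C}$. -}

module Defs where

open import Level using (0ℓ)
open import Data.Product using (Σ; _×_; ∃; ∃-syntax; _,_)
open import Data.Sum using (_⊎_)
open import Relation.Nullary using (¬_)
open import Relation.Binary.PropositionalEquality using (_≡_)
open import Function.Bundles using (_⇔_)

data Form (At : Set) : Set where
  atom : At → Form At
  _∧'_ : Form At → Form At → Form At
  _∨'_ : Form At → Form At → Form At
  ¬'_  : Form At → Form At

record Pair (At : Set) : Set where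
  constructor _⊢_
  field
    lhs : Form At
    rhs : Form At

record RoutleyIF : Set₁ where
  infixl 7 _∘_
  infix 8 _*
  infix 4 _≤_
  field
    S     : Set
    _∘_   : S → S → S
    _*    : S → S
    i     : S
    e     : S
    assoc : ∀ s t u → (s ∘ t) ∘ u ≡ s ∘ (t ∘ u)
    comm  : ∀ s t → s ∘ t ≡ t ∘ s
    idem  : ∀ s → s ∘ s ≡ s
    i≢e   : ¬ (i ≡ e)
    unitʳ : ∀ s → s ∘ i ≡ s
    zeroʳ : ∀ s → s ∘ e ≡ e
    e-prime : ∀ t u → e ≡ t ∘ u → (e ≡ t) ⊎ (e ≡ u)

  _≤_ : S → S → Set
  s ≤ t = s ∘ t ≡ s

  field
    i*≡e   : i * ≡ e
    e*≡i   : e * ≡ i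
    *-anti : ∀ {t u} → t ≤ u → u * ≤ t *
    *-split : ∀ t u → ((t ∘ u) * ≤ t *) ⊎ ((t ∘ u) * ≤ u *)

module _ (I : RoutleyIF) where
  open RoutleyIF I

  record ProperFilter : Set₁ where
    field
      mem     : S → Set
      i∈      : mem i
      e∉      : ¬ mem e
      ∘-closed : ∀ t u → (mem (t ∘ u) → mem t × mem u) × (mem t × mem u → mem (t ∘ u))

  -- A Routley IM based on I is I together with a valuation At → ProperFilter.
  Valuation : Set → Set₁
  Valuation At = At → ProperFilter

  _,_⊩_ : {At : Set} → Valuation At → S → Form At → Set
  V , s ⊩ atom p   = ProperFilter.mem (V p) s
  V , s ⊩ (α ∧' β) = (V , s ⊩ α) × (V , s ⊩ β)
  V , s ⊩ (α ∨' β) = ∃[ t ] ∃[ u ] ((V , t ⊩ α) × (V , u ⊩ β) × (t ∘ u ≤ s))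
  V , s ⊩ (¬' α)   = ¬ (V , (s *) ⊩ α)

  ValidInModel : {At : Set} → Valuation At → Pair At → Set
  ValidInModel V (α ⊢ β) = ∀ s → V , s ⊩ α → V , s ⊩ β

  ValidInFrame : {At : Set} → Pair At → Set₁
  ValidInFrame P = ∀ V → ValidInModel V P

Characterizes : {At : Set} → Pair At → (RoutleyIF → Set) → Set₁
Characterizes P C = ∀ (I : RoutleyIF) → ValidInFrame I P ⇔ C I

CondA : RoutleyIF → Set
CondA I = ∀ s → s ≤ (s *) *
  where open RoutleyIF I

CondB : RoutleyIF → Set
CondB I = ∀ s → (s *) * ≤ s
  where open RoutleyIF I

CondC : RoutleyIF → Set
CondC I = ∀ s t u → t ∘ u ≤ s * → (t ≤ s *) ⊎ (u ≤ s *)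
  where open RoutleyIF I

{-# OPTIONS --safe #-}
module Submission where

-- Soundness of each pair is upward closure of filters under ≤.  For the
-- converse, a failure of the frame condition at some states yields a
-- valuation by principal filters ↑ a, which are proper exactly because a
-- state with a ≰ b cannot be the bottom e; in that model the pair fails.
-- Excluded middle turns the resulting double negation into the condition
-- and decides equality of atoms for the two-filter valuation of (c).

open import Defs
open import Level using (0ℓ)
open import Data.Product using (_×_; _,_; proj₁; proj₂)
open import Data.Sum using (inj₁; inj₂)
open import Data.Empty using (⊥-elim)
open import Function using (_∘′_)
open import Function.Bundles using (mk⇔)
open import Relation.Nullary using (¬_; yes; no)
open import Relation.Binary.Definitions using (DecidableEquality)
open import Relation.Binary.PropositionalEquality using (_≡_; refl; sym; trans; cong; subst; module ≡-Reasoning)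
open import Axiom.ExcludedMiddle using (ExcludedMiddle)
open import Axiom.DoubleNegationElimination using (DoubleNegationElimination; em⇒dne)

module Frame (I : RoutleyIF) where
  open RoutleyIF I
  open ProperFilter

  e≤x : ∀ s → e ≤ s
  e≤x s = trans (comm e s) (zeroʳ s)

  ≤-trans : ∀ {a b c} → a ≤ b → b ≤ c → a ≤ c
  ≤-trans {a} {b} {c} a≤b b≤c = begin
    a ∘ c        ≡⟨ cong (_∘ c) (sym a≤b) ⟩
    a ∘ b ∘ c    ≡⟨ assoc a b c ⟩
    a ∘ (b ∘ c)  ≡⟨ cong (a ∘_) b≤c ⟩
    a ∘ b        ≡⟨ a≤b ⟩
    a            ∎
    where open ≡-Reasoning

  x∘y≤x : ∀ t u → t ∘ u ≤ t
  x∘y≤x t u = begin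
    t ∘ u ∘ t    ≡⟨ assoc t u t ⟩
    t ∘ (u ∘ t)  ≡⟨ cong (t ∘_) (comm u t) ⟩
    t ∘ (t ∘ u)  ≡⟨ sym (assoc t t u) ⟩
    t ∘ t ∘ u    ≡⟨ cong (_∘ u) (idem t) ⟩
    t ∘ u        ∎
    where open ≡-Reasoning

  x∘y≤y : ∀ t u → t ∘ u ≤ u
  x∘y≤y t u = trans (assoc t u u) (cong (t ∘_) (idem u))

  ≰⇒≢e : ∀ {a b} → ¬ (a ≤ b) → ¬ (a ≡ e)
  ≰⇒≢e a≰b refl = a≰b (e≤x _)

  ↑ : (a : S) → ¬ (a ≡ e) → ProperFilter I
  ↑ a a≢e = record
    { mem      = a ≤_
    ; i∈       = unitʳ a
    ; e∉       = λ a≤e → a≢e (trans (sym a≤e) (zeroʳ a))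
    ; ∘-closed = λ t u →
        (λ a≤tu → ≤-trans a≤tu (x∘y≤x t u) , ≤-trans a≤tu (x∘y≤y t u))
      , λ (a≤t , a≤u) → trans (sym (assoc a t u)) (trans (cong (_∘ u) a≤t) a≤u)
    }

  mem-upward : ∀ (F : ProperFilter I) {a b} → mem F a → a ≤ b → mem F b
  mem-upward F {a} {b} a∈F a≤b =
    proj₂ (proj₁ (∘-closed F a b) (subst (mem F) (sym a≤b) a∈F))

  module TwoPoint {At : Set} (_≟_ : DecidableEquality At) (p : At) (F G : ProperFilter I) where

    V : Valuation I At
    V x with x ≟ p
    ... | yes _ = F
    ... | no  _ = G

    V-at : V p ≡ F
    V-at with p ≟ p
    ... | yes _   = refl
    ... | no  p≢p = ⊥-elim (p≢p refl)

    V-other : ∀ {q} → ¬ (q ≡ p) → V q ≡ G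
    V-other {q} q≢p with q ≟ p
    ... | yes q≡p = ⊥-elim (q≢p q≡p)
    ... | no  _   = refl

module Characterization (dne : DoubleNegationElimination 0ℓ) (I : RoutleyIF) {At : Set} where
  open RoutleyIF I
  open ProperFilter
  open Frame I

  module _ (p : At) where

    p⊢¬¬p : Pair At
    p⊢¬¬p = atom p ⊢ (¬' (¬' atom p))

    ¬¬p⊢p : Pair At
    ¬¬p⊢p = (¬' (¬' atom p)) ⊢ atom p

    condA⇒p⊢¬¬p : CondA I → ValidInFrame I p⊢¬¬p
    condA⇒p⊢¬¬p s≤s** V s s⊩p s**⊮p = s**⊮p (mem-upward (V p) s⊩p (s≤s** s))

    p⊢¬¬p⇒condA : ValidInFrame I p⊢¬¬p → CondA I
    p⊢¬¬p⇒condA valid s = dne λ s≰s** →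
      valid (λ _ → ↑ s (≰⇒≢e s≰s**)) s (idem s) s≰s**

    condB⇒¬¬p⊢p : CondB I → ValidInFrame I ¬¬p⊢p
    condB⇒¬¬p⊢p s**≤s V s s⊩¬¬p = mem-upward (V p) (dne s⊩¬¬p) (s**≤s s)

    ¬¬p⊢p⇒condB : ValidInFrame I ¬¬p⊢p → CondB I
    ¬¬p⊢p⇒condB valid s = dne λ s**≰s →
      s**≰s (valid (λ _ → ↑ (s * *) (≰⇒≢e s**≰s)) s (λ s**⊮p → s**⊮p (idem (s * *))))

  module _ (p q : At) where

    ¬p∧¬q⊢¬[p∨q] : Pair At
    ¬p∧¬q⊢¬[p∨q] = ((¬' atom p) ∧' (¬' atom q)) ⊢ (¬' (atom p ∨' atom q))

    condC⇒¬p∧¬q⊢¬[p∨q] : CondC I → ValidInFrame I ¬p∧¬q⊢¬[p∨q]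
    condC⇒¬p∧¬q⊢¬[p∨q] prime V s (s*⊮p , s*⊮q) (t , u , t⊩p , u⊩q , tu≤s*)
      with prime s t u tu≤s*
    ... | inj₁ t≤s* = s*⊮p (mem-upward (V p) t⊩p t≤s*)
    ... | inj₂ u≤s* = s*⊮q (mem-upward (V q) u⊩q u≤s*)

    -- The counter-model puts p true exactly above t and q exactly above u.
    ¬p∧¬q⊢¬[p∨q]⇒condC : DecidableEquality At → ¬ (p ≡ q) →
                          ValidInFrame I ¬p∧¬q⊢¬[p∨q] → CondC I
    ¬p∧¬q⊢¬[p∨q]⇒condC _≟_ p≢q valid s t u tu≤s* = dne λ neither →
      let t≰s* = neither ∘′ inj₁
          u≰s* = neither ∘′ inj₂
          open TwoPoint _≟_ p (↑ t (≰⇒≢e t≰s*)) (↑ u (≰⇒≢e u≰s*))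
      in valid V s
           ( subst (λ F → ¬ mem F (s *)) (sym V-at) t≰s*
           , subst (λ F → ¬ mem F (s *)) (sym (V-other (p≢q ∘′ sym))) u≰s* )
           ( t , u
           , subst (λ F → mem F t) (sym V-at) (idem t)
           , subst (λ F → mem F u) (sym (V-other (p≢q ∘′ sym))) (idem u)
           , tu≤s* )

proposition5 : ExcludedMiddle 0ℓ → (At : Set) → (p q : At) → ¬ (p ≡ q) →
    Characterizes (atom p ⊢ (¬' (¬' atom p))) CondA
    × Characterizes ((¬' (¬' atom p)) ⊢ atom p) CondB
    × Characterizes (((¬' atom p) ∧' (¬' atom q)) ⊢ (¬' (atom p ∨' atom q))) CondC
proposition5 em At p q p≢q =
    (λ I → let open Characterization dne I in mk⇔ (p⊢¬¬p⇒condA p) (condA⇒p⊢¬¬p p))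
  , (λ I → let open Characterization dne I in mk⇔ (¬¬p⊢p⇒condB p) (condB⇒¬¬p⊢p p))
  , (λ I → let open Characterization dne I in
       mk⇔ (¬p∧¬q⊢¬[p∨q]⇒condC p q _≟_ p≢q) (condC⇒¬p∧¬q⊢¬[p∨q] p q))
  where
  dne : DoubleNegationElimination 0ℓ
  dne = em⇒dne em

  _≟_ : DecidableEquality At
  _ ≟ _ = em
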